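{- Let $A$ be a set of input nodes (layer $0$) of the standard $d$-dimensional butterfly, $d\ge 1$. Then there is a set of $|A|$ edges from layer $0$ to layer $1$, one leaving each node of $A$ and with pairwise distinct heads, such that exactly $\lceil |A|/2\rceil$ of the heads have first label bit $0$ and $\lfloor |A|/2\rfloor$ have first label bit $1$. Likewise there is such a set of edges with exactly $\lceil |A|/2\rceil$ heads having first bit $1$ and $\lfloor |A|/2\rfloor$ having first bit $0$. Symmetrically, let $B$ be a set of output nodes (layer $d$) of the standard $d$-dimensional butterfly. Then there is a set of $|B|$ edges from layer $d-1$ to layer $d$, one entering each node of $B$ and with pairwise distinct tails, such that exactly $\lceil |B|/2\rceil$ of the tails have last label bit $0$ and $\lfloor |B|/2\rfloor$ have last label bit $1$. Likewise with the roles of $0$ and $1$ exchanged.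
   Context: The standard $d$-dimensional butterfly is the directed graph with nodes $(i,b)$, where $i\in\{0,\dots,d\}$ is the layer and $b=b_1\cdots b_d\in\{0,1\}^d$ is the label. For $1\le i\le d$ there are edges from $(i-1,b)$ to the two nodes $(i,b')$ where $b'$ agrees with $b$ except possibly in coordinate $i$. Layer-$0$ nodes are input nodes and layer-$d$ nodes are output nodes. -}

module Defs where

open import Data.Nat using (ℕ; suc; ⌈_/2⌉; ⌊_/2⌋)
open import Data.Bool using (Bool; not)
open import Data.Bool.Properties using () renaming (_≟_ to _≟ᵇ_)
open import Data.Fin using (Fin; zero; fromℕ)
open import Data.Vec using (Vec; lookup)
open import Data.List using (List; map; length; filter)
open import Data.List.Relation.Unary.All using (All)
open import Data.List.Relation.Unary.Unique.Propositional using (Unique)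
open import Data.List.Relation.Binary.Permutation.Propositional using (_↭_)
open import Data.Product using (_×_; ∃; proj₁; proj₂)
open import Relation.Binary.PropositionalEquality using (_≡_; _≢_)

-- Labels b = b_1 ⋯ b_d of the d-dimensional butterfly; coordinate b_k is
-- `lookup b (k-1)` (Fin indices are 0-based).
Label : ℕ → Set
Label d = Vec Bool d

-- Butterfly edge from (i-1, b) to (i, b') where the coordinate i is given as
-- the 0-based index c : Fin d (c = i - 1): b' agrees with b except possibly at c.
IsEdge : {d : ℕ} → Fin d → Label d → Label d → Set
IsEdge c b b' = ∀ j → j ≢ c → lookup b j ≡ lookup b' j

countBit : {d : ℕ} → Fin d → Bool → List (Label d) → ℕ
countBit c x L = length (filter (λ b → lookup b c ≟ᵇ x) L)

-- An edge is a pair (tail label, head label).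
-- Input side (d = suc n): A is a set of layer-0 nodes (by labels).
BalancedIn : (n : ℕ) → List (Label (suc n)) → Bool → Set
BalancedIn n A x =
  ∃ λ (E : List (Label (suc n) × Label (suc n))) →
    All (λ e → IsEdge zero (proj₁ e) (proj₂ e)) E
    × (map proj₁ E ↭ A)
    × Unique (map proj₂ E)
    × countBit zero x (map proj₂ E) ≡ ⌈ length A /2⌉
    × countBit zero (not x) (map proj₂ E) ≡ ⌊ length A /2⌋

-- Output side: B is a set of layer-d nodes.
BalancedOut : (n : ℕ) → List (Label (suc n)) → Bool → Set
BalancedOut n B x =
  ∃ λ (E : List (Label (suc n) × Label (suc n))) →
    All (λ e → IsEdge (fromℕ n) (proj₁ e) (proj₂ e)) E
    × (map proj₂ E ↭ B)
    × Unique (map proj₁ E)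
    × countBit (fromℕ n) x (map proj₁ E) ≡ ⌈ length B /2⌉
    × countBit (fromℕ n) (not x) (map proj₁ E) ≡ ⌊ length B /2⌋

-- Fix a coordinate c and pair each label b with flip b, the label differing
-- from b exactly at c; an edge along c never leaves its pair. If b and flip b both occur, they are sent to themselves,
-- contributing one head of each bit. Otherwise b may be sent to either member
-- of its pair, so its head supplies the majority bit x, and the rest is
-- balanced towards not x. Heads remain distinct because no other tail lies in
-- b's pair. The output side is the input side of the reversed edges along the
-- last coordinate.
module Submission where

open import Defs
open import Data.Nat using (ℕ; suc; _≤_; s≤s; ⌈_/2⌉; ⌊_/2⌋)
open import Data.Nat.Properties using (≤-refl; <⇒≤)
open import Data.Bool using (Bool; true; false; not)
open import Data.Bool.Properties using (not-involutive; not-¬; ¬-not) renaming (_≟_ to _≟ᵇ_)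
open import Data.Fin using (Fin; zero; fromℕ) renaming (_≟_ to _≟ᶠ_)
open import Data.Vec using (Vec; lookup; _[_]≔_)
open import Data.Vec.Properties
  using (tabulate∘lookup; tabulate-cong; lookup∘update; lookup∘update′; ≡-dec)
open import Data.List using (List; []; _∷_; _++_; map; length)
open import Data.List.Properties using (filter-accept; filter-reject; map-∘)
open import Data.List.Relation.Unary.All as All using (All; []; _∷_)
open import Data.List.Relation.Unary.All.Properties using (All¬⇒¬Any; ¬Any⇒All¬; map⁺)
open import Data.List.Relation.Unary.Any using (here; there)
open import Data.List.Relation.Unary.Unique.Propositional using (Unique; []; _∷_)
open import Data.List.Relation.Binary.Permutation.Propositional
  using (_↭_; ↭-refl; ↭-sym; ↭-trans; prep; ↭⇒↭ₛ)
open import Data.List.Relation.Binary.Permutation.Propositional.Properties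
  using (shift; ↭-length; ∈-resp-↭)
open import Data.List.Membership.Propositional using (_∈_; _∉_)
open import Data.List.Membership.Propositional.Properties using (∈-∃++; ∈-map⁻; ∈-map⁺)
open import Data.Product using (_×_; _,_; ∃; proj₁; proj₂; swap)
open import Data.Sum using (_⊎_; inj₁; inj₂)
open import Relation.Nullary using (Dec; yes; no)
open import Relation.Binary.PropositionalEquality
  using (_≡_; _≢_; refl; sym; trans; cong; subst; ≢-sym; setoid)
import Data.List.Relation.Binary.Permutation.Setoid.Properties as PermutationSetoid

lookup-ext : ∀ {A : Set} {n} {u v : Vec A n} → (∀ i → lookup u i ≡ lookup v i) → u ≡ v
lookup-ext {u = u} {v} u≗v =
  trans (sym (tabulate∘lookup u)) (trans (tabulate-cong u≗v) (tabulate∘lookup v))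

Unique-resp-↭ : ∀ {A : Set} {xs ys : List A} → xs ↭ ys → Unique xs → Unique ys
Unique-resp-↭ {A} p = PermutationSetoid.Unique-resp-↭ (setoid A) (↭⇒↭ₛ p)

∈⇒↭∷ : ∀ {A : Set} {v : A} {xs} → v ∈ xs → ∃ λ ys → xs ↭ v ∷ ys
∈⇒↭∷ {v = v} v∈xs with ∈-∃++ v∈xs
... | ys , zs , refl = ys ++ zs , shift v ys zs

module AlongCoordinate {d : ℕ} (c : Fin d) where

  open import Data.List.Membership.DecPropositional (≡-dec {n = d} _≟ᵇ_) using (_∈?_)

  isEdge-refl : ∀ b → IsEdge c b b
  isEdge-refl _ _ _ = refl

  isEdge-sym : ∀ {b b′} → IsEdge c b b′ → IsEdge c b′ b
  isEdge-sym e j j≢c = sym (e j j≢c)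

  isEdge-trans : ∀ {b b′ b″} → IsEdge c b b′ → IsEdge c b′ b″ → IsEdge c b b″
  isEdge-trans e e′ j j≢c = trans (e j j≢c) (e′ j j≢c)

  isEdge-update : ∀ b x → IsEdge c b (b [ c ]≔ x)
  isEdge-update b x j j≢c = sym (lookup∘update′ j≢c b x)

  bit : Label d → Bool
  bit b = lookup b c

  flip : Label d → Label d
  flip b = b [ c ]≔ not (bit b)

  bit-flip : ∀ b → bit (flip b) ≡ not (bit b)
  bit-flip b = lookup∘update c b (not (bit b))

  isEdge⇒≡⊎≡flip : ∀ {t b} → IsEdge c t b → t ≡ b ⊎ t ≡ flip b
  isEdge⇒≡⊎≡flip {t} {b} e with bit t ≟ᵇ bit b
  ... | yes t≡b = inj₁ (lookup-ext agree)
    where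
    agree : ∀ j → lookup t j ≡ lookup b j
    agree j with j ≟ᶠ c
    ... | yes refl = t≡b
    ... | no j≢c = e j j≢c
  ... | no t≢b = inj₂ (lookup-ext agree)
    where
    agree : ∀ j → lookup t j ≡ lookup (flip b) j
    agree j with j ≟ᶠ c
    ... | yes refl = trans (¬-not t≢b) (sym (bit-flip b))
    ... | no j≢c = trans (e j j≢c) (isEdge-update b _ j j≢c)

  countBit-accept : ∀ {x} h L → bit h ≡ x → countBit c x (h ∷ L) ≡ suc (countBit c x L)
  countBit-accept h L h≡x = cong length (filter-accept (λ b → bit b ≟ᵇ _) {x = h} {xs = L} h≡x)

  countBit-reject : ∀ {x} h L → bit h ≢ x → countBit c x (h ∷ L) ≡ countBit c x L
  countBit-reject h L h≢x = cong length (filter-reject (λ b → bit b ≟ᵇ _) {x = h} {xs = L} h≢x)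

  bit-flip-≢ : ∀ b {x} → bit b ≡ x → bit (flip b) ≢ x
  bit-flip-≢ b refl flip≡b = not-¬ refl (trans (sym flip≡b) (bit-flip b))

  bit-flip-≡ : ∀ b {x} → bit b ≢ x → bit (flip b) ≡ x
  bit-flip-≡ b b≢x = trans (bit-flip b) (sym (¬-not (≢-sym b≢x)))

  flip≢ : ∀ b → flip b ≢ b
  flip≢ b flip≡b = bit-flip-≢ b refl (cong bit flip≡b)

  countBit-flip-pair : ∀ x b L → countBit c x (b ∷ flip b ∷ L) ≡ suc (countBit c x L)
  countBit-flip-pair x b L = by-cases (bit b ≟ᵇ x)
    where
    by-cases : Dec (bit b ≡ x) → countBit c x (b ∷ flip b ∷ L) ≡ suc (countBit c x L)
    by-cases (yes b≡x) = trans (countBit-accept b (flip b ∷ L) b≡x)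
                               (cong suc (countBit-reject (flip b) L (bit-flip-≢ b b≡x)))
    by-cases (no b≢x) = trans (countBit-reject b (flip b ∷ L) b≢x)
                              (countBit-accept (flip b) L (bit-flip-≡ b b≢x))

  -- BalancedIn n A x unfolds to BalancedAt zero A x.
  BalancedAt : List (Label d) → Bool → Set
  BalancedAt L x =
    ∃ λ (E : List (Label d × Label d)) →
      All (λ e → IsEdge c (proj₁ e) (proj₂ e)) E
      × (map proj₁ E ↭ L)
      × Unique (map proj₂ E)
      × countBit c x (map proj₂ E) ≡ ⌈ length L /2⌉
      × countBit c (not x) (map proj₂ E) ≡ ⌊ length L /2⌋

  head∉ : ∀ {E L b h} → All (λ e → IsEdge c (proj₁ e) (proj₂ e)) E → map proj₁ E ↭ L →
          b ∉ L → flip b ∉ L → IsEdge c b h → h ∉ map proj₂ E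
  head∉ {b = b} {h} edges tails b∉L flip∉L b-h h∈heads with ∈-map⁻ proj₂ h∈heads
  ... | (t , .h) , e∈E , refl
    with isEdge⇒≡⊎≡flip {t} {b}
           (isEdge-trans {t} {h} {b} (All.lookup edges e∈E) (isEdge-sym {b} {h} b-h))
  ...   | inj₁ refl = b∉L (∈-resp-↭ tails (∈-map⁺ proj₁ e∈E))
  ...   | inj₂ refl = flip∉L (∈-resp-↭ tails (∈-map⁺ proj₁ e∈E))

  balanced-resp-↭ : ∀ {L L′ x} → L ↭ L′ → BalancedAt L x → BalancedAt L′ x
  balanced-resp-↭ L↭L′ (E , edges , tails , unique , count-x , count-not-x) =
    E , edges , ↭-trans tails L↭L′ , unique ,
    trans count-x (cong ⌈_/2⌉ (↭-length L↭L′)) ,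
    trans count-not-x (cong ⌊_/2⌋ (↭-length L↭L′))

  balanced-∷ : ∀ {b L x} → b ∉ L → flip b ∉ L → BalancedAt L (not x) → BalancedAt (b ∷ L) x
  balanced-∷ {b} {L} {x} b∉L flip∉L (E , edges , tails , unique , count-not-x , count-x) =
    (b , h) ∷ E , isEdge-update b x ∷ edges , prep b tails ,
    ¬Any⇒All¬ _ (head∉ edges tails b∉L flip∉L (isEdge-update b x)) ∷ unique ,
    trans (countBit-accept h _ bit-h)
          (cong suc (subst (λ y → countBit c y (map proj₂ E) ≡ _) (not-involutive x) count-x)) ,
    trans (countBit-reject h _ (not-¬ bit-h)) count-not-x
    where
    h : Label d
    h = b [ c ]≔ x
    bit-h : bit h ≡ x
    bit-h = lookup∘update c b x

  balanced-∷-flip : ∀ {b L x} → b ∉ L → flip b ∉ L → BalancedAt L x → BalancedAt (b ∷ flip b ∷ L) x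
  balanced-∷-flip {b} {L} {x} b∉L flip∉L (E , edges , tails , unique , count-x , count-not-x) =
    (b , b) ∷ (flip b , flip b) ∷ E , isEdge-refl b ∷ isEdge-refl (flip b) ∷ edges ,
    prep b (prep (flip b) tails) ,
    ¬Any⇒All¬ _ b∉heads ∷ ¬Any⇒All¬ _ flip∉heads ∷ unique ,
    trans (countBit-flip-pair x b _) (cong suc count-x) ,
    trans (countBit-flip-pair (not x) b _) (cong suc count-not-x)
    where
    flip∉heads : flip b ∉ map proj₂ E
    flip∉heads = head∉ edges tails b∉L flip∉L (isEdge-update b _)
    b∉heads : b ∉ flip b ∷ map proj₂ E
    b∉heads (here b≡flip) = flip≢ b (sym b≡flip)
    b∉heads (there b∈heads) = head∉ edges tails b∉L flip∉L (isEdge-refl b) b∈heads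

  balanced-≤ : ∀ k L → length L ≤ k → Unique L → ∀ x → BalancedAt L x
  balanced-≤ _ [] _ _ _ = [] , [] , ↭-refl , [] , refl , refl
  balanced-≤ (suc k) (b ∷ L) (s≤s |L|≤k) (b∉L ∷ unique) x with flip b ∈? L
  ... | no flip∉L = balanced-∷ (All¬⇒¬Any b∉L) flip∉L (balanced-≤ k L |L|≤k unique (not x))
  ... | yes flip∈L with ∈⇒↭∷ flip∈L
  ...   | L′ , L↭ with Unique-resp-↭ (prep b L↭) (b∉L ∷ unique)
  ...     | (_ ∷ b∉L′) ∷ flip∉L′ ∷ unique′ =
    balanced-resp-↭ (prep b (↭-sym L↭))
      (balanced-∷-flip (All¬⇒¬Any b∉L′) (All¬⇒¬Any flip∉L′)
        (balanced-≤ k L′ (<⇒≤ (subst (_≤ k) (↭-length L↭) |L|≤k)) unique′ x))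

  balanced : ∀ L → Unique L → ∀ x → BalancedAt L x
  balanced L = balanced-≤ (length L) L ≤-refl

open AlongCoordinate using (BalancedAt; balanced; isEdge-sym)

reverse-balanced : ∀ n {B x} → BalancedAt (fromℕ n) B x → BalancedOut n B x
reverse-balanced n (E , edges , tails , unique , count-x , count-not-x) =
  map swap E , map⁺ (All.map (λ {e} → isEdge-sym (fromℕ n) {proj₁ e} {proj₂ e}) edges) ,
  subst (_↭ _) (map-∘ E) tails , subst Unique (map-∘ E) unique ,
  subst (λ tls → countBit _ _ tls ≡ _) (map-∘ E) count-x ,
  subst (λ tls → countBit _ _ tls ≡ _) (map-∘ E) count-not-x

lemma4 : (n : ℕ) →
    ((A : List (Label (suc n))) → Unique A →
       BalancedIn n A false × BalancedIn n A true)
    × ((B : List (Label (suc n))) → Unique B →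
       BalancedOut n B false × BalancedOut n B true)
lemma4 n = (λ A u → balanced zero A u false , balanced zero A u true)
         , (λ B u → balancedOut B u false , balancedOut B u true)
  where
  balancedOut : ∀ B → Unique B → ∀ x → BalancedOut n B x
  balancedOut B u x = reverse-balanced n (balanced (fromℕ n) B u x)
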